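{- Let $\{t_n:n\ge1\}$ be a sequence of nonnegative integers, let $\{f_n(x):n\ge1\}$ be polynomials with $\deg f_n(x)=n+t_n$ for all $n\ge1$, and let $\{g_n(x):n\ge0\}$ be polynomials with $\deg g_n(x)\le n$ for all $n\ge 0$, $g_0$ a nonzero constant, and $g_n(-\lambda_n/a_n)\neq 0$ for all $n\ge1$. Then \[ B=\{f_n(x)/d_{t_n}(x):n\ge1\}\cup\{g_n(x)/d_n(x):n\ge 0\} \] is a basis of the vector space $V$.
   Context: Let $\{b_n\}_{n\ge0},\{a_n\}_{n\ge0},\{\lambda_n\}_{n\ge0}$ be sequences of complex numbers. Define monic polynomials $P_n(x)$ by $P_{ -1}(x)=0$, $P_0(x)=1$ and $P_{n+1}(x)=(x-b_n)P_n(x)-(a_nx+\lambda_n)P_{n-1}(x)$ for $n\ge0$. Let $d_0(x)=1$, $d_m(x)=\prod_{i=1}^m(a_ix+\lambda_i)$, and $Q_m(x)=P_m(x)/d_m(x)$. Assume $a_n\neq0$ and $P_n(-\lambda_n/a_n)\neq 0$ for all $n\ge1$. Let $V=\mathrm{span}\{x^nQ_m(x):n,m\ge0\}$, a vector space of rational functions. -}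

module Defs where

open import Level using (Level; _⊔_) renaming (suc to lsuc)
open import Algebra.Bundles using (CommutativeRing)
open import Data.Nat using (ℕ; zero; suc; _<_; _∸_) renaming (_+_ to _+ℕ_; _⊔_ to _⊔ℕ_)
open import Data.List using (List; []; _∷_; map; foldr)
open import Data.List.Relation.Unary.All using (All)
open import Data.List.Relation.Unary.Unique.Propositional using (Unique)
open import Data.Product using (_×_; _,_; proj₁; proj₂; ∃)
open import Data.Sum using (_⊎_; inj₁; inj₂)
open import Relation.Nullary using (¬_)

record Field (c ℓ : Level) : Set (lsuc (c ⊔ ℓ)) where
  field
    commutativeRing : CommutativeRing c ℓ
  open CommutativeRing commutativeRing public
  field
    0≉1     : ¬ (0# ≈ 1#)
    inv     : (x : Carrier) → ¬ (x ≈ 0#) → Carrier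
    inverse : (x : Carrier) (nz : ¬ (x ≈ 0#)) → x * inv x nz ≈ 1#

module _ {c ℓ : Level} (F : Field c ℓ) where
  open Field F

  -- Polynomials over F: coefficient lists, lowest degree first.

  Poly : Set c
  Poly = List Carrier

  coeff : Poly → ℕ → Carrier
  coeff []      _       = 0#
  coeff (x ∷ p) zero    = x
  coeff (x ∷ p) (suc k) = coeff p k

  -- equality of polynomials (coefficientwise, trailing zeros ignored)
  _≈ₚ_ : Poly → Poly → Set ℓ
  p ≈ₚ q = (k : ℕ) → coeff p k ≈ coeff q k

  infixl 6 _+ₚ_
  infixl 7 _*ₚ_ _·ₚ_

  _+ₚ_ : Poly → Poly → Poly
  []      +ₚ q       = q
  (x ∷ p) +ₚ []      = x ∷ p
  (x ∷ p) +ₚ (y ∷ q) = (x + y) ∷ (p +ₚ q)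

  _·ₚ_ : Carrier → Poly → Poly
  s ·ₚ p = map (s *_) p

  _*ₚ_ : Poly → Poly → Poly
  []      *ₚ q = []
  (x ∷ p) *ₚ q = (x ·ₚ q) +ₚ (0# ∷ (p *ₚ q))

  constP : Carrier → Poly
  constP s = s ∷ []

  oneP : Poly
  oneP = constP 1#

  X : Poly
  X = 0# ∷ 1# ∷ []

  Xpow : ℕ → Poly
  Xpow zero    = oneP
  Xpow (suc n) = X *ₚ Xpow n

  eval : Poly → Carrier → Carrier
  eval []      r = 0#
  eval (x ∷ p) r = x + r * eval p r

  HasDegree : Poly → ℕ → Set ℓ
  HasDegree p n = ¬ (coeff p n ≈ 0#) × ((k : ℕ) → n < k → coeff p k ≈ 0#)

  DegreeAtMost : Poly → ℕ → Set ℓ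
  DegreeAtMost p n = (k : ℕ) → n < k → coeff p k ≈ 0#

  module _ (b a lam : ℕ → Carrier) where

    linF : ℕ → Poly
    linF i = lam i ∷ a i ∷ []

    -- (P_{n-1}, P_n)
    Ppair : ℕ → Poly × Poly
    Ppair zero    = [] , oneP
    Ppair (suc n) with Ppair n
    ... | (p' , p) = p , ((((- b n) ∷ 1# ∷ []) *ₚ p) +ₚ ((- 1#) ·ₚ (linF n *ₚ p')))

    P : ℕ → Poly
    P n = proj₂ (Ppair n)

    d : ℕ → Poly
    d zero    = oneP
    d (suc m) = d m *ₚ linF (suc m)

    -- ∏_{i=m+1}^{m+k} (a_i x + λ_i)   (so d_{m+k} = d_m · dquot m k)
    dquot : ℕ → ℕ → Poly
    dquot m zero    = oneP
    dquot m (suc k) = dquot m k *ₚ linF (m +ℕ suc k)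

    -- Rational functions with denominator of the form d_m:
    -- (p , m) stands for p(x) / d_m(x).  Since every d_m is a nonzero
    -- polynomial (a_i ≠ 0), p/d_m = q/d_k in F(x) iff p d_k = q d_m.

    RF : Set c
    RF = Poly × ℕ

    _≈ᵣ_ : RF → RF → Set ℓ
    (p , m) ≈ᵣ (q , k) = (p *ₚ d k) ≈ₚ (q *ₚ d m)

    zeroR : RF
    zeroR = [] , 0

    _+ᵣ_ : RF → RF → RF
    (p , m) +ᵣ (q , k) =
      let M = m ⊔ℕ k in
      ((p *ₚ dquot m (M ∸ m)) +ₚ (q *ₚ dquot k (M ∸ k))) , M

    _·ᵣ_ : Carrier → RF → RF
    s ·ᵣ (p , m) = (s ·ₚ p) , m

    linComb : List (Carrier × RF) → RF
    linComb = foldr (λ { (s , r) acc → (s ·ᵣ r) +ᵣ acc }) zeroR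

    combFam : {I : Set} → (I → RF) → List (Carrier × I) → RF
    combFam B L = linComb (map (λ { (s , i) → s , B i }) L)

    -- x^n Q_m(x) = x^n P_m(x) / d_m(x)
    xQ : ℕ × ℕ → RF
    xQ (n , m) = (Xpow n *ₚ P m) , m

    InV : RF → Set (c ⊔ ℓ)
    InV r = ∃ λ (L : List (Carrier × (ℕ × ℕ))) → combFam xQ L ≈ᵣ r

    IsBasisOfV : {I : Set} → (I → RF) → Set (c ⊔ ℓ)
    IsBasisOfV {I} B =
        ((i : I) → InV (B i))
      × ((r : RF) → InV r → ∃ λ (L : List (Carrier × I)) → combFam B L ≈ᵣ r)
      × ((L : List (Carrier × I)) → Unique (map proj₂ L) →
           combFam B L ≈ᵣ zeroR → All (λ sc → proj₁ sc ≈ 0#) L)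

  rootPt : (a lam : ℕ → Carrier) (n : ℕ) → ¬ (a n ≈ 0#) → Carrier
  rootPt a lam n nz = (- lam n) * inv (a n) nz

  familyB : (t : ℕ → ℕ) (f g : ℕ → Poly) → ℕ ⊎ ℕ → Poly × ℕ
  familyB t f g (inj₁ n) = f (suc n) , t (suc n)
  familyB t f g (inj₂ n) = g n , n

module Submission where

-- Every fraction p / d_m lies in V: Q_0 = 1 gives the polynomials, and since P_{m+1}(ρ_m) ≠ 0 at the
-- root ρ_m = -λ_{m+1}/a_{m+1} of the last factor of d_{m+1}, subtracting a multiple of Q_{m+1} from
-- p / d_{m+1} leaves a fraction over d_m.  The same reduction with g_{m+1} in place of P_{m+1}, together
-- with cancelling top coefficients against the f_n (deg (f_n d_N / d_{t_n}) = N + n), shows that B spans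
-- all such fractions.  For independence, write a vanishing combination over a common d_N: the f_n with
-- the largest n is the only term of degree N + n, and once the f-terms are gone, g_N is the only term
-- not vanishing at ρ_{N-1}; dividing by the linear factor lowers N, and g_0 ≠ 0 ends the induction.

open import Defs
open import Level using (Level; _⊔_)
open import Function using (_∘_)
open import Data.Nat using (ℕ; zero; suc; _∸_; _≤_; _<_; _≤′_; ≤′-refl; ≤′-step; z≤n; s≤s)
  renaming (_+_ to _+ℕ_; _⊔_ to _⊔ℕ_)
import Data.Nat.Properties as ℕ
open import Data.Maybe using (nothing)
open import Data.Product using (Σ; _×_; _,_; proj₁; proj₂; ∃)
open import Data.Sum using (_⊎_; inj₁; inj₂)
open import Data.Sum.Properties using (≡-dec)
open import Data.List using (List; []; _∷_; length; map)
open import Data.List.Relation.Unary.All as All using (All; []; _∷_)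
import Data.List.Relation.Unary.All.Properties as AllP
open import Data.List.Relation.Unary.AllPairs.Core using ([]; _∷_)
open import Data.List.Relation.Unary.Unique.Propositional using (Unique)
open import Relation.Nullary using (¬_; yes; no; contradiction)
open import Relation.Binary using (Setoid; IsEquivalence)
open import Relation.Binary.Definitions using (DecidableEquality)
open import Relation.Binary.PropositionalEquality as ≡ using (_≡_; _≢_; cong)
import Relation.Binary.Reasoning.Setoid as SetoidReasoning
open import Algebra.Bundles using (CommutativeRing)
open import Tactic.RingSolver.Core.AlmostCommutativeRing using (AlmostCommutativeRing; fromCommutativeRing)
open import Tactic.RingSolver using (solve-∀)

module FieldFacts {c ℓ : Level} (F : Field c ℓ) where
  open Field F
  open SetoidReasoning setoid

  nonzero-*-cancel : ∀ {x y} → ¬ (x ≈ 0#) → x * y ≈ 0# → y ≈ 0#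
  nonzero-*-cancel {x} {y} x≉0 xy≈0 = begin
    y                    ≈⟨ *-identityˡ y ⟨
    1# * y               ≈⟨ *-congʳ (trans (*-comm _ _) (inverse x x≉0)) ⟨
    (inv x x≉0 * x) * y  ≈⟨ *-assoc _ _ _ ⟩
    inv x x≉0 * (x * y)  ≈⟨ *-congˡ xy≈0 ⟩
    inv x x≉0 * 0#       ≈⟨ zeroʳ _ ⟩
    0#                   ∎

  *-nonzero : ∀ {x y} → ¬ (x ≈ 0#) → ¬ (y ≈ 0#) → ¬ (x * y ≈ 0#)
  *-nonzero x≉0 y≉0 xy≈0 = y≉0 (nonzero-*-cancel x≉0 xy≈0)

  inv-*-cancelʳ : ∀ x {y} (y≉0 : ¬ (y ≈ 0#)) → (x * inv y y≉0) * y ≈ x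
  inv-*-cancelʳ x {y} y≉0 = begin
    (x * inv y y≉0) * y  ≈⟨ *-assoc _ _ _ ⟩
    x * (inv y y≉0 * y)  ≈⟨ *-congˡ (trans (*-comm _ _) (inverse y y≉0)) ⟩
    x * 1#               ≈⟨ *-identityʳ x ⟩
    x                    ∎

module FieldIdentities {c ℓ : Level} (F : Field c ℓ) where
  private
    ACR : AlmostCommutativeRing c ℓ
    ACR = fromCommutativeRing (Field.commutativeRing F) (λ _ → nothing)

  open AlmostCommutativeRing ACR

  distrib-+-cons : ∀ (x y q u v : Carrier) → (x + y) * q + (u + v) ≈ (x * q + u) + (y * q + v)
  distrib-+-cons = solve-∀ ACR

  +-swap : ∀ (u v w : Carrier) → u + (v + w) ≈ v + (u + w)
  +-swap = solve-∀ ACR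

  horner-+ : ∀ (x y r u v : Carrier) → (x + y) + r * (u + v) ≈ (x + r * u) + (y + r * v)
  horner-+ = solve-∀ ACR

  horner-· : ∀ (s x r u : Carrier) → s * x + r * (s * u) ≈ s * (x + r * u)
  horner-· = solve-∀ ACR

module Polynomials {c ℓ : Level} (F : Field c ℓ) where
  open Field F hiding (zero)
  open FieldFacts F
  private module Identities = FieldIdentities F
  open import Algebra.Properties.Ring ring using (-1*x≈-x)

  Pol : Set c
  Pol = Poly F

  coef : Pol → ℕ → Carrier
  coef = coeff F

  infix  4 _≋_
  infixl 6 _+P_
  infixl 7 _*P_ _·P_

  _+P_ : Pol → Pol → Pol
  _+P_ = _+ₚ_ F

  _*P_ : Pol → Pol → Pol
  _*P_ = _*ₚ_ F

  _·P_ : Carrier → Pol → Pol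
  _·P_ = _·ₚ_ F

  -P_ : Pol → Pol
  -P p = (- 1#) ·P p

  shift : Pol → Pol
  shift p = 0# ∷ p

  -- A record rather than Defs._≈ₚ_ so that both polynomials stay inferable.
  record _≋_ (p q : Pol) : Set ℓ where
    constructor coeffwise
    field coef≈ : (k : ℕ) → coef p k ≈ coef q k
  open _≋_ public

  ≋-refl : ∀ {p} → p ≋ p
  ≋-refl = coeffwise λ _ → refl

  ≋-sym : ∀ {p q} → p ≋ q → q ≋ p
  ≋-sym p≋q = coeffwise λ k → sym (coef≈ p≋q k)

  ≋-trans : ∀ {p q r} → p ≋ q → q ≋ r → p ≋ r
  ≋-trans p≋q q≋r = coeffwise λ k → trans (coef≈ p≋q k) (coef≈ q≋r k)

  ≋-reflexive : ∀ {p q} → p ≡ q → p ≋ q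
  ≋-reflexive ≡.refl = ≋-refl

  ≋-isEquivalence : IsEquivalence _≋_
  ≋-isEquivalence = record { refl = ≋-refl ; sym = ≋-sym ; trans = ≋-trans }

  ≋-setoid : Setoid c ℓ
  ≋-setoid = record { isEquivalence = ≋-isEquivalence }

  module ≋-Reasoning = SetoidReasoning ≋-setoid

  coef-+ : ∀ p q k → coef (p +P q) k ≈ coef p k + coef q k
  coef-+ []      q       k       = sym (+-identityˡ _)
  coef-+ (x ∷ p) []      k       = sym (+-identityʳ _)
  coef-+ (x ∷ p) (y ∷ q) zero    = refl
  coef-+ (x ∷ p) (y ∷ q) (suc k) = coef-+ p q k

  coef-· : ∀ s p k → coef (s ·P p) k ≈ s * coef p k
  coef-· s []      k       = sym (zeroʳ s)
  coef-· s (x ∷ p) zero    = refl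
  coef-· s (x ∷ p) (suc k) = coef-· s p k

  coef--P : ∀ p k → coef (-P p) k ≈ - coef p k
  coef--P p k = trans (coef-· (- 1#) p k) (-1*x≈-x _)

  coef-∷*-zero : ∀ x p q → coef ((x ∷ p) *P q) zero ≈ x * coef q zero
  coef-∷*-zero x p q = trans (coef-+ (x ·P q) (shift (p *P q)) zero) (trans (+-identityʳ _) (coef-· x q zero))

  coef-∷*-suc : ∀ x p q k → coef ((x ∷ p) *P q) (suc k) ≈ x * coef q (suc k) + coef (p *P q) k
  coef-∷*-suc x p q k = trans (coef-+ (x ·P q) (shift (p *P q)) (suc k)) (+-congʳ (coef-· x q (suc k)))

  coef-shift[] : ∀ k → coef (shift []) k ≈ 0#
  coef-shift[] zero    = refl
  coef-shift[] (suc k) = refl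

  coef-≥length : ∀ p k → length p ≤ k → coef p k ≈ 0#
  coef-≥length []      k       _         = refl
  coef-≥length (x ∷ p) (suc k) (s≤s le) = coef-≥length p k le

  ∷-≋-tail : ∀ {x y p q} → (x ∷ p) ≋ (y ∷ q) → p ≋ q
  ∷-≋-tail h = coeffwise λ k → coef≈ h (suc k)

  ∷-≋[]-tail : ∀ {x p} → (x ∷ p) ≋ [] → p ≋ []
  ∷-≋[]-tail h = coeffwise λ k → coef≈ h (suc k)

  +P-cong : ∀ {p p' q q'} → p ≋ p' → q ≋ q' → p +P q ≋ p' +P q'
  +P-cong {p} {p'} {q} {q'} p≋p' q≋q' = coeffwise λ k →
    trans (coef-+ p q k) (trans (+-cong (coef≈ p≋p' k) (coef≈ q≋q' k)) (sym (coef-+ p' q' k)))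

  ·P-cong : ∀ {s s' p p'} → s ≈ s' → p ≋ p' → s ·P p ≋ s' ·P p'
  ·P-cong {s} {s'} {p} {p'} s≈s' p≋p' = coeffwise λ k →
    trans (coef-· s p k) (trans (*-cong s≈s' (coef≈ p≋p' k)) (sym (coef-· s' p' k)))

  shift-cong : ∀ {p q} → p ≋ q → shift p ≋ shift q
  shift-cong h = coeffwise λ { zero → refl ; (suc k) → coef≈ h k }

  *P-zeroˡ : ∀ p q → p ≋ [] → p *P q ≋ []
  *P-zeroˡ []      q h = ≋-refl
  *P-zeroˡ (x ∷ p) q h = coeffwise λ
    { zero    → trans (coef-∷*-zero x p q) (x≈0⇒x*y≈0 (coef≈ h zero))
    ; (suc k) → trans (coef-∷*-suc x p q k)
                  (trans (+-cong (x≈0⇒x*y≈0 (coef≈ h zero)) (coef≈ (*P-zeroˡ p q (∷-≋[]-tail h)) k))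
                         (+-identityʳ _)) }
    where x≈0⇒x*y≈0 : ∀ {x y} → x ≈ 0# → x * y ≈ 0#
          x≈0⇒x*y≈0 x≈0 = trans (*-congʳ x≈0) (zeroˡ _)

  *P-zeroʳ : ∀ p → p *P [] ≋ []
  *P-zeroʳ []      = ≋-refl
  *P-zeroʳ (x ∷ p) = coeffwise λ { zero → refl ; (suc k) → coef≈ (*P-zeroʳ p) k }

  *P-congʳ : ∀ {p p'} q → p ≋ p' → p *P q ≋ p' *P q
  *P-congʳ {[]}    {[]}     q h = ≋-refl
  *P-congʳ {[]}    {y ∷ p'} q h = ≋-sym (*P-zeroˡ (y ∷ p') q (≋-sym h))
  *P-congʳ {x ∷ p} {[]}     q h = *P-zeroˡ (x ∷ p) q h
  *P-congʳ {x ∷ p} {y ∷ p'} q h = coeffwise λ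
    { zero    → trans (coef-∷*-zero x p q) (trans (*-congʳ (coef≈ h zero)) (sym (coef-∷*-zero y p' q)))
    ; (suc k) → trans (coef-∷*-suc x p q k)
                  (trans (+-cong (*-congʳ (coef≈ h zero)) (coef≈ (*P-congʳ q (∷-≋-tail h)) k))
                         (sym (coef-∷*-suc y p' q k))) }

  *P-congˡ : ∀ p {q q'} → q ≋ q' → p *P q ≋ p *P q'
  *P-congˡ []      h = ≋-refl
  *P-congˡ (x ∷ p) {q} {q'} h = coeffwise λ
    { zero    → trans (coef-∷*-zero x p q) (trans (*-congˡ (coef≈ h zero)) (sym (coef-∷*-zero x p q')))
    ; (suc k) → trans (coef-∷*-suc x p q k)
                  (trans (+-cong (*-congˡ (coef≈ h (suc k))) (coef≈ (*P-congˡ p h) k))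
                         (sym (coef-∷*-suc x p q' k))) }

  +P-comm : ∀ p q → p +P q ≋ q +P p
  +P-comm p q = coeffwise λ k → trans (coef-+ p q k) (trans (+-comm _ _) (sym (coef-+ q p k)))

  +P-assoc : ∀ p q r → (p +P q) +P r ≋ p +P (q +P r)
  +P-assoc p q r = coeffwise λ k → begin
    coef ((p +P q) +P r) k          ≈⟨ trans (coef-+ (p +P q) r k) (+-congʳ (coef-+ p q k)) ⟩
    (coef p k + coef q k) + coef r k ≈⟨ +-assoc _ _ _ ⟩
    coef p k + (coef q k + coef r k) ≈⟨ trans (coef-+ p (q +P r) k) (+-congˡ (coef-+ q r k)) ⟨
    coef (p +P (q +P r)) k          ∎
    where open SetoidReasoning setoid

  +P-identityʳ : ∀ p → p +P [] ≋ p
  +P-identityʳ p = coeffwise λ k → trans (coef-+ p [] k) (+-identityʳ _)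

  -P-inverseʳ : ∀ p → p +P -P p ≋ []
  -P-inverseʳ p = coeffwise λ k → trans (coef-+ p (-P p) k) (trans (+-congˡ (coef--P p k)) (-‿inverseʳ _))

  -P-inverseˡ : ∀ p → -P p +P p ≋ []
  -P-inverseˡ p = ≋-trans (+P-comm (-P p) p) (-P-inverseʳ p)

  ·P-distribʳ : ∀ s t p → (s + t) ·P p ≋ s ·P p +P t ·P p
  ·P-distribʳ s t p = coeffwise λ k → trans (coef-· (s + t) p k)
    (trans (distribʳ _ _ _) (sym (trans (coef-+ (s ·P p) (t ·P p) k) (+-cong (coef-· s p k) (coef-· t p k)))))

  ·P-zero : ∀ p → 0# ·P p ≋ []
  ·P-zero p = coeffwise λ k → trans (coef-· 0# p k) (zeroˡ _)

  *P-distribʳ : ∀ q p p' → (p +P p') *P q ≋ p *P q +P p' *P q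
  *P-distribʳ q []      p'       = ≋-refl
  *P-distribʳ q (x ∷ p) []       = ≋-sym (+P-identityʳ ((x ∷ p) *P q))
  *P-distribʳ q (x ∷ p) (y ∷ p') = coeffwise λ
    { zero → begin
      coef (((x + y) ∷ (p +P p')) *P q) zero           ≈⟨ coef-∷*-zero (x + y) (p +P p') q ⟩
      (x + y) * coef q zero                            ≈⟨ distribʳ _ _ _ ⟩
      x * coef q zero + y * coef q zero                ≈⟨ +-cong (coef-∷*-zero x p q) (coef-∷*-zero y p' q) ⟨
      coef ((x ∷ p) *P q) zero + coef ((y ∷ p') *P q) zero ≈⟨ coef-+ ((x ∷ p) *P q) ((y ∷ p') *P q) zero ⟨
      coef ((x ∷ p) *P q +P (y ∷ p') *P q) zero        ∎
    ; (suc k) → begin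
      coef (((x + y) ∷ (p +P p')) *P q) (suc k)
        ≈⟨ coef-∷*-suc (x + y) (p +P p') q k ⟩
      (x + y) * coef q (suc k) + coef ((p +P p') *P q) k
        ≈⟨ +-congˡ (trans (coef≈ (*P-distribʳ q p p') k) (coef-+ (p *P q) (p' *P q) k)) ⟩
      (x + y) * coef q (suc k) + (coef (p *P q) k + coef (p' *P q) k)
        ≈⟨ Identities.distrib-+-cons x y (coef q (suc k)) _ _ ⟩
      (x * coef q (suc k) + coef (p *P q) k) + (y * coef q (suc k) + coef (p' *P q) k)
        ≈⟨ +-cong (coef-∷*-suc x p q k) (coef-∷*-suc y p' q k) ⟨
      coef ((x ∷ p) *P q) (suc k) + coef ((y ∷ p') *P q) (suc k)
        ≈⟨ coef-+ ((x ∷ p) *P q) ((y ∷ p') *P q) (suc k) ⟨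
      coef ((x ∷ p) *P q +P (y ∷ p') *P q) (suc k) ∎ }
    where open SetoidReasoning setoid

  ·P-*P-assoc : ∀ s p q → (s ·P p) *P q ≋ s ·P (p *P q)
  ·P-*P-assoc s []      q = ≋-refl
  ·P-*P-assoc s (x ∷ p) q = coeffwise λ
    { zero → trans (coef-∷*-zero (s * x) (s ·P p) q)
               (trans (*-assoc _ _ _) (sym (trans (coef-· s ((x ∷ p) *P q) zero) (*-congˡ (coef-∷*-zero x p q)))))
    ; (suc k) → trans (coef-∷*-suc (s * x) (s ·P p) q k)
               (trans (+-cong (*-assoc _ _ _) (trans (coef≈ (·P-*P-assoc s p q) k) (coef-· s (p *P q) k)))
               (trans (sym (distribˡ _ _ _))
                      (sym (trans (coef-· s ((x ∷ p) *P q) (suc k)) (*-congˡ (coef-∷*-suc x p q k)))))) }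

  *P-∷ : ∀ q x p → q *P (x ∷ p) ≋ x ·P q +P shift (q *P p)
  *P-∷ [] x p = coeffwise λ k → sym (coef-shift[] k)
  *P-∷ (y ∷ q) x p = coeffwise λ
    { zero → trans (coef-∷*-zero y q (x ∷ p))
               (trans (*-comm _ _) (sym (trans (coef-+ (x ·P (y ∷ q)) (shift ((y ∷ q) *P p)) zero) (+-identityʳ _))))
    ; (suc k) → begin
      coef ((y ∷ q) *P (x ∷ p)) (suc k)                    ≈⟨ coef-∷*-suc y q (x ∷ p) k ⟩
      y * coef p k + coef (q *P (x ∷ p)) k                 ≈⟨ +-congˡ (trans (coef≈ (*P-∷ q x p) k) (coef-+ (x ·P q) (shift (q *P p)) k)) ⟩
      y * coef p k + (coef (x ·P q) k + coef (shift (q *P p)) k) ≈⟨ Identities.+-swap _ _ _ ⟩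
      coef (x ·P q) k + (y * coef p k + coef (shift (q *P p)) k) ≈⟨ +-congˡ (trans (coef-+ (y ·P p) (shift (q *P p)) k) (+-congʳ (coef-· y p k))) ⟨
      coef (x ·P q) k + coef ((y ∷ q) *P p) k              ≈⟨ coef-+ (x ·P (y ∷ q)) (shift ((y ∷ q) *P p)) (suc k) ⟨
      coef (x ·P (y ∷ q) +P shift ((y ∷ q) *P p)) (suc k)  ∎ }
    where open SetoidReasoning setoid

  *P-comm : ∀ p q → p *P q ≋ q *P p
  *P-comm []      q = ≋-sym (*P-zeroʳ q)
  *P-comm (x ∷ p) q = ≋-trans (+P-cong ≋-refl (shift-cong (*P-comm p q))) (≋-sym (*P-∷ q x p))

  shift-*P : ∀ p q → shift p *P q ≋ shift (p *P q)
  shift-*P p q = +P-cong (·P-zero q) ≋-refl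

  *P-assoc : ∀ p q r → (p *P q) *P r ≋ p *P (q *P r)
  *P-assoc []      q r = ≋-refl
  *P-assoc (x ∷ p) q r = begin
    (x ·P q +P shift (p *P q)) *P r       ≈⟨ *P-distribʳ r (x ·P q) (shift (p *P q)) ⟩
    (x ·P q) *P r +P shift (p *P q) *P r  ≈⟨ +P-cong (·P-*P-assoc x q r) (shift-*P (p *P q) r) ⟩
    x ·P (q *P r) +P shift ((p *P q) *P r) ≈⟨ +P-cong ≋-refl (shift-cong (*P-assoc p q r)) ⟩
    x ·P (q *P r) +P shift (p *P (q *P r)) ∎
    where open ≋-Reasoning

  *P-distribˡ : ∀ p q q' → p *P (q +P q') ≋ p *P q +P p *P q'
  *P-distribˡ p q q' =
    ≋-trans (*P-comm p (q +P q')) (≋-trans (*P-distribʳ p q q') (+P-cong (*P-comm q p) (*P-comm q' p)))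

  *P-identityˡ : ∀ p → oneP F *P p ≋ p
  *P-identityˡ p = coeffwise λ k →
    trans (coef-+ (1# ·P p) (shift []) k) (trans (+-cong (coef-· 1# p k) (coef-shift[] k)) (trans (+-identityʳ _) (*-identityˡ _)))

  *P-identityʳ : ∀ p → p *P oneP F ≋ p
  *P-identityʳ p = ≋-trans (*P-comm p (oneP F)) (*P-identityˡ p)

  X-*P : ∀ p → X F *P p ≋ shift p
  X-*P p = +P-cong (·P-zero p) (shift-cong (*P-identityˡ p))

  polynomialRing : CommutativeRing c ℓ
  polynomialRing = record
    { Carrier = Pol ; _≈_ = _≋_ ; _+_ = _+P_ ; _*_ = _*P_ ; -_ = -P_ ; 0# = [] ; 1# = oneP F
    ; isCommutativeRing = record
      { isRing = record
        { +-isAbelianGroup = record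
          { isGroup = record
            { isMonoid = record
              { isSemigroup = record
                { isMagma = record { isEquivalence = ≋-isEquivalence ; ∙-cong = +P-cong }
                ; assoc = +P-assoc }
              ; identity = (λ _ → ≋-refl) , +P-identityʳ }
            ; inverse = -P-inverseˡ , -P-inverseʳ
            ; ⁻¹-cong = ·P-cong refl }
          ; comm = +P-comm }
        ; *-cong = λ {p} {p'} {q} h g → ≋-trans (*P-congʳ q h) (*P-congˡ p' g)
        ; *-assoc = *P-assoc
        ; *-identity = *P-identityˡ , *P-identityʳ
        ; distrib = *P-distribˡ , *P-distribʳ }
      ; *-comm = *P-comm } }

  ev : Pol → Carrier → Carrier
  ev = eval F

  ev-+ : ∀ p q r → ev (p +P q) r ≈ ev p r + ev q r
  ev-+ []      q       r = sym (+-identityˡ _)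
  ev-+ (x ∷ p) []      r = sym (+-identityʳ _)
  ev-+ (x ∷ p) (y ∷ q) r = trans (+-congˡ (*-congˡ (ev-+ p q r))) (Identities.horner-+ x y r _ _)

  ev-· : ∀ s p r → ev (s ·P p) r ≈ s * ev p r
  ev-· s []      r = sym (zeroʳ s)
  ev-· s (x ∷ p) r = trans (+-congˡ (*-congˡ (ev-· s p r))) (Identities.horner-· s x r _)

  ev--P : ∀ p r → ev (-P p) r ≈ - ev p r
  ev--P p r = trans (ev-· (- 1#) p r) (-1*x≈-x _)

  ev-* : ∀ p q r → ev (p *P q) r ≈ ev p r * ev q r
  ev-* []      q r = sym (zeroˡ _)
  ev-* (x ∷ p) q r = begin
    ev (x ·P q +P shift (p *P q)) r            ≈⟨ ev-+ (x ·P q) (shift (p *P q)) r ⟩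
    ev (x ·P q) r + (0# + r * ev (p *P q) r)    ≈⟨ +-cong (ev-· x q r) (trans (+-identityˡ _) (*-congˡ (ev-* p q r))) ⟩
    x * ev q r + r * (ev p r * ev q r)          ≈⟨ +-congˡ (*-assoc _ _ _) ⟨
    x * ev q r + (r * ev p r) * ev q r          ≈⟨ distribʳ _ _ _ ⟨
    (x + r * ev p r) * ev q r                   ∎
    where open SetoidReasoning setoid

  ev-≋[] : ∀ p r → p ≋ [] → ev p r ≈ 0#
  ev-≋[] []      r h = refl
  ev-≋[] (x ∷ p) r h =
    trans (+-cong (coef≈ h zero) (trans (*-congˡ (ev-≋[] p r (∷-≋[]-tail h))) (zeroʳ r))) (+-identityʳ _)

  ev-cong : ∀ {p q} r → p ≋ q → ev p r ≈ ev q r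
  ev-cong {[]}    {[]}    r h = refl
  ev-cong {[]}    {y ∷ q} r h = sym (ev-≋[] (y ∷ q) r (≋-sym h))
  ev-cong {x ∷ p} {[]}    r h = ev-≋[] (x ∷ p) r h
  ev-cong {x ∷ p} {y ∷ q} r h = +-cong (coef≈ h zero) (*-congˡ (ev-cong r (∷-≋-tail h)))


  record LinearFunctional : Set (c ⊔ ℓ) where
    field
      apply   : Pol → Carrier
      apply-+ : ∀ p q → apply (p +P q) ≈ apply p + apply q
      apply-· : ∀ s p → apply (s ·P p) ≈ s * apply p
      apply-≋[] : ∀ p → p ≋ [] → apply p ≈ 0#

  coefficientAt : ℕ → LinearFunctional
  coefficientAt k = record
    { apply = λ p → coef p k ; apply-+ = λ p q → coef-+ p q k
    ; apply-· = λ s p → coef-· s p k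
    ; apply-≋[] = λ p p≋[] → coef≈ p≋[] k }

  evaluationAt : Carrier → LinearFunctional
  evaluationAt r = record
    { apply = λ p → ev p r ; apply-+ = λ p q → ev-+ p q r
    ; apply-· = λ s p → ev-· s p r
    ; apply-≋[] = λ p → ev-≋[] p r }

  Deg≤ : Pol → ℕ → Set ℓ
  Deg≤ = DegreeAtMost F

  Deg≤-+ : ∀ {p q n} → Deg≤ p n → Deg≤ q n → Deg≤ (p +P q) n
  Deg≤-+ {p} {q} dp dq k n<k = trans (coef-+ p q k) (trans (+-cong (dp k n<k) (dq k n<k)) (+-identityʳ _))

  Deg≤-· : ∀ {p n} s → Deg≤ p n → Deg≤ (s ·P p) n
  Deg≤-· {p} s dp k n<k = trans (coef-· s p k) (trans (*-congˡ (dp k n<k)) (zeroʳ s))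

  Deg≤--P : ∀ {p n} → Deg≤ p n → Deg≤ (-P p) n
  Deg≤--P {p} = Deg≤-· {p} (- 1#)

  Deg≤-mono : ∀ {p m n} → m ≤ n → Deg≤ p m → Deg≤ p n
  Deg≤-mono m≤n dp k n<k = dp k (ℕ.≤-<-trans m≤n n<k)

  Deg≤-length : ∀ p → Deg≤ p (length p)
  Deg≤-length p k lt = coef-≥length p k (ℕ.<⇒≤ lt)

  Deg≤-*P : ∀ p q i j → Deg≤ p i → Deg≤ q j →
            Deg≤ (p *P q) (i +ℕ j) × (coef (p *P q) (i +ℕ j) ≈ coef p i * coef q j)
  Deg≤-*P []      q i       j dp dq = (λ _ _ → refl) , sym (zeroˡ _)
  Deg≤-*P (x ∷ p) q zero    j dp dq = bound , top j
    where
      p*q≋[] : p *P q ≋ []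
      p*q≋[] = *P-zeroˡ p q (coeffwise λ k → dp (suc k) (s≤s z≤n))
      bound : Deg≤ ((x ∷ p) *P q) j
      bound (suc k) j<k = trans (coef-∷*-suc x p q k)
        (trans (+-cong (trans (*-congˡ (dq (suc k) j<k)) (zeroʳ x)) (coef≈ p*q≋[] k)) (+-identityʳ _))
      top : ∀ j → coef ((x ∷ p) *P q) j ≈ x * coef q j
      top zero    = coef-∷*-zero x p q
      top (suc j) = trans (coef-∷*-suc x p q j) (trans (+-congˡ (coef≈ p*q≋[] j)) (+-identityʳ _))
  Deg≤-*P (x ∷ p) q (suc i) j dp dq = bound , top
    where
      ih = Deg≤-*P p q i j (λ k lt → dp (suc k) (s≤s lt)) dq
      x*q-vanishes : ∀ k → i +ℕ j ≤ k → x * coef q (suc k) ≈ 0#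
      x*q-vanishes k le = trans (*-congˡ (dq (suc k) (s≤s (ℕ.≤-trans (ℕ.m≤n+m j i) le)))) (zeroʳ x)
      bound : Deg≤ ((x ∷ p) *P q) (suc i +ℕ j)
      bound (suc k) (s≤s lt) = trans (coef-∷*-suc x p q k)
        (trans (+-cong (x*q-vanishes k (ℕ.<⇒≤ lt)) (proj₁ ih k lt)) (+-identityʳ _))
      top : coef ((x ∷ p) *P q) (suc i +ℕ j) ≈ coef p i * coef q j
      top = trans (coef-∷*-suc x p q (i +ℕ j)) (trans (+-cong (x*q-vanishes (i +ℕ j) ℕ.≤-refl) (proj₂ ih)) (+-identityˡ _))


  leadingRatio : (p h : Pol) (n : ℕ) → ¬ (coef h n ≈ 0#) → Carrier
  leadingRatio p h n h≉0 = coef p n * inv (coef h n) h≉0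

  cancel-leading : ∀ p h n (h-deg : HasDegree F h n) → Deg≤ p n →
    ∀ k → n ≤ k → coef (p +P -P (leadingRatio p h n (proj₁ h-deg) ·P h)) k ≈ 0#
  cancel-leading p h n (h≉0 , dh) dp k n≤k with ℕ.m≤n⇒m<n∨m≡n n≤k
  ... | inj₁ n<k = Deg≤-+ {p} { -P (ratio ·P h)} dp (Deg≤--P {ratio ·P h} (Deg≤-· {h} ratio dh)) k n<k
    where ratio = leadingRatio p h n h≉0
  ... | inj₂ ≡.refl = begin
    coef (p +P -P (ratio ·P h)) n   ≈⟨ trans (coef-+ p (-P (ratio ·P h)) n) (+-congˡ (coef--P (ratio ·P h) n)) ⟩
    coef p n + - coef (ratio ·P h) n ≈⟨ +-congˡ (-‿cong (trans (coef-· ratio h n) (inv-*-cancelʳ _ h≉0))) ⟩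
    coef p n + - coef p n       ≈⟨ -‿inverseʳ _ ⟩
    0#                          ∎
    where
      open SetoidReasoning setoid
      ratio = leadingRatio p h n h≉0

module PolynomialIdentities {c ℓ : Level} (F : Field c ℓ) where
  private
    ACR : AlmostCommutativeRing c ℓ
    ACR = fromCommutativeRing (Polynomials.polynomialRing F) (λ _ → nothing)

  open AlmostCommutativeRing ACR

  *-interchange : ∀ (u v w z : Carrier) → (u * v) * (w * z) ≈ (u * z) * (v * w)
  *-interchange = solve-∀ ACR

  +-swap : ∀ (u v w : Carrier) → u + (v + w) ≈ v + (u + w)
  +-swap = solve-∀ ACR

module CommonDenominators {c ℓ : Level} (F : Field c ℓ) (b a lam : ℕ → Field.Carrier F)
                          (a≠0 : (n : ℕ) → ¬ (Field._≈_ F (a (suc n)) (Field.0# F))) where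
  open Field F hiding (zero)
  open FieldFacts F
  open Polynomials F
  private module PI = PolynomialIdentities F
  open import Algebra.Properties.Ring (CommutativeRing.ring polynomialRing) using () renaming (x∙y⁻¹≈ε⇒x≈y to -P-≋[]⇒≋)

  lin : ℕ → Pol
  lin = linF F b a lam

  den : ℕ → Pol
  den = d F b a lam

  dq : ℕ → ℕ → Pol
  dq = dquot F b a lam

  Frac : Set c
  Frac = RF F b a lam

  a≉0 : ∀ {i} → 0 < i → ¬ (a i ≈ 0#)
  a≉0 (s≤s _) = a≠0 _

  coef-lin*-zero : ∀ i G → coef (lin i *P G) zero ≈ lam i * coef G zero
  coef-lin*-zero i G = coef-∷*-zero (lam i) (a i ∷ []) G

  coef-lin*-suc : ∀ i G k → coef (lin i *P G) (suc k) ≈ lam i * coef G (suc k) + a i * coef G k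
  coef-lin*-suc i G k = trans (coef-∷*-suc (lam i) (a i ∷ []) G k) (+-congˡ (coef-a*P k))
    where coef-a*P : ∀ k → coef ((a i ∷ []) *P G) k ≈ a i * coef G k
          coef-a*P zero    = coef-∷*-zero (a i) [] G
          coef-a*P (suc k) = trans (coef-∷*-suc (a i) [] G k) (+-identityʳ _)

  -- Since a_i ≠ 0, the relation λ_i c_{k+1} + a_i c_k = 0 forces c_k = 0 once c_{k+1} = 0;
  -- descend from the length of G, where the coefficients are 0.
  coef-vanishing-descends : ∀ i → 0 < i → ∀ G K →
    (∀ k → K ≤ k → coef (lin i *P G) (suc k) ≈ 0#) → ∀ k → K ≤ k → coef G k ≈ 0#
  coef-vanishing-descends i 0<i G K hyp k K≤k = descend (length G) k K≤k (ℕ.m≤m+n (length G) k)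
    where
      descend : ∀ j k → K ≤ k → length G ≤ j +ℕ k → coef G k ≈ 0#
      descend zero    k K≤k le = coef-≥length G k le
      descend (suc j) k K≤k le = nonzero-*-cancel (a≉0 0<i) (begin
        a i * coef G k                            ≈⟨ +-identityˡ _ ⟨
        0# + a i * coef G k                       ≈⟨ +-congʳ (trans (*-congˡ next≈0) (zeroʳ _)) ⟨
        lam i * coef G (suc k) + a i * coef G k   ≈⟨ coef-lin*-suc i G k ⟨
        coef (lin i *P G) (suc k)                 ≈⟨ hyp k K≤k ⟩
        0#                                        ∎)
        where
          open SetoidReasoning setoid
          next≈0 : coef G (suc k) ≈ 0#
          next≈0 = descend j (suc k) (ℕ.m≤n⇒m≤1+n K≤k) (≡.subst (length G ≤_) (≡.sym (ℕ.+-suc j k)) le)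

  lin-*P-cancel : ∀ i → 0 < i → ∀ G → lin i *P G ≋ [] → G ≋ []
  lin-*P-cancel i 0<i G h = coeffwise λ k → coef-vanishing-descends i 0<i G 0 (λ k _ → coef≈ h (suc k)) k z≤n

  lin-*P-Deg≤ : ∀ i → 0 < i → ∀ G m → Deg≤ (lin i *P G) (suc m) → Deg≤ G m
  lin-*P-Deg≤ i 0<i G m dG k m<k = coef-vanishing-descends i 0<i G (suc m) (λ j m<j → dG (suc j) (s≤s m<j)) k m<k

  den-*P-cancel : ∀ N p q → p *P den N ≋ q *P den N → p ≋ q
  den-*P-cancel N p q h = -P-≋[]⇒≋ p q (cancel N (p +P -P q) (begin
      (p +P -P q) *P den N             ≈⟨ *P-distribʳ (den N) p (-P q) ⟩
      p *P den N +P -P q *P den N      ≈⟨ +P-cong h (·P-*P-assoc (- 1#) q (den N)) ⟩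
      q *P den N +P -P (q *P den N)    ≈⟨ -P-inverseʳ (q *P den N) ⟩
      []                               ∎))
    where
      open ≋-Reasoning
      cancel : ∀ N G → G *P den N ≋ [] → G ≋ []
      cancel zero    G h = ≋-trans (≋-sym (*P-identityʳ G)) h
      cancel (suc N) G h = cancel N G (lin-*P-cancel (suc N) (s≤s z≤n) (G *P den N)
        (≋-trans (*P-comm (lin (suc N)) (G *P den N)) (≋-trans (*P-assoc G (den N) (lin (suc N))) h)))

  Deg≤-lin : ∀ i → Deg≤ (lin i) 1
  Deg≤-lin i (suc zero)    (s≤s ())
  Deg≤-lin i (suc (suc k)) _ = refl

  -- dquot m k = a_{m+1} … a_{m+k} x^k + lower terms
  dq-HasDegree : ∀ m k → HasDegree F (dq m k) k
  dq-HasDegree m zero    = (λ 0≈1 → 0≉1 (sym 0≈1)) , λ { (suc k) _ → refl }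
  dq-HasDegree m (suc k) = top≉0 , ≡.subst (Deg≤ (dq m (suc k))) k+1≡1+k (proj₁ product)
    where
      ih = dq-HasDegree m k
      product = Deg≤-*P (dq m k) (lin (m +ℕ suc k)) k 1 (proj₂ ih) (Deg≤-lin _)
      k+1≡1+k : k +ℕ 1 ≡ suc k
      k+1≡1+k = ℕ.+-comm k 1
      top≉0 : ¬ (coef (dq m (suc k)) (suc k) ≈ 0#)
      top≉0 = *-nonzero (proj₁ ih) (a≉0 (ℕ.<-≤-trans (s≤s z≤n) (ℕ.m≤n+m (suc k) m))) ∘
                trans (sym (≡.subst (λ j → coef (dq m (suc k)) j ≈ coef (dq m k) k * a (m +ℕ suc k)) k+1≡1+k (proj₂ product)))

  -- p / d_m rewritten over the larger denominator d_N has numerator p · dquot m (N ∸ m).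
  numeratorAt : ℕ → Frac → Pol
  numeratorAt N (p , m) = p *P dq m (N ∸ m)

  numeratorAt-self : ∀ p m → numeratorAt m (p , m) ≋ p
  numeratorAt-self p m = ≋-trans (≋-reflexive (cong (λ k → p *P dq m k) (ℕ.n∸n≡0 m))) (*P-identityʳ p)

  numeratorAt-suc : ∀ p {m N} → m ≤ N → numeratorAt (suc N) (p , m) ≋ numeratorAt N (p , m) *P lin (suc N)
  numeratorAt-suc p {m} {N} m≤N = begin
    p *P dq m (suc N ∸ m)                  ≡⟨ cong (λ k → p *P dq m k) (ℕ.+-∸-assoc 1 m≤N) ⟩
    p *P (dq m (N ∸ m) *P lin (m +ℕ suc (N ∸ m)))
      ≡⟨ cong (λ j → p *P (dq m (N ∸ m) *P lin j)) (≡.trans (ℕ.+-suc m (N ∸ m)) (cong suc (ℕ.m+[n∸m]≡n m≤N))) ⟩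
    p *P (dq m (N ∸ m) *P lin (suc N))     ≈⟨ *P-assoc p (dq m (N ∸ m)) (lin (suc N)) ⟨
    p *P dq m (N ∸ m) *P lin (suc N)       ∎
    where open ≋-Reasoning

  numeratorAt-numeratorAt : ∀ p {m M N} → m ≤ M → M ≤ N →
                            numeratorAt N (numeratorAt M (p , m) , M) ≋ numeratorAt N (p , m)
  numeratorAt-numeratorAt p {m} {M} m≤M M≤N = go (ℕ.≤⇒≤′ M≤N)
    where
      go : ∀ {N} → M ≤′ N → numeratorAt N (numeratorAt M (p , m) , M) ≋ numeratorAt N (p , m)
      go ≤′-refl = numeratorAt-self _ M
      go (≤′-step {N} M≤′N) = let M≤N = ℕ.≤′⇒≤ M≤′N in
        ≋-trans (numeratorAt-suc (numeratorAt M (p , m)) M≤N)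
          (≋-trans (*P-congʳ _ (go M≤′N)) (≋-sym (numeratorAt-suc p (ℕ.≤-trans m≤M M≤N))))

  den-numeratorAt : ∀ {m N} → m ≤ N → den N ≋ numeratorAt N (den m , m)
  den-numeratorAt {m} m≤N = go (ℕ.≤⇒≤′ m≤N)
    where
      go : ∀ {N} → m ≤′ N → den N ≋ numeratorAt N (den m , m)
      go ≤′-refl = ≋-sym (numeratorAt-self _ m)
      go (≤′-step {N} m≤′N) = ≋-trans (*P-congʳ _ (go m≤′N)) (≋-sym (numeratorAt-suc (den m) (ℕ.≤′⇒≤ m≤′N)))

  numeratorAt-+ᵣ : ∀ N r r' → proj₂ r ⊔ℕ proj₂ r' ≤ N →
                   numeratorAt N (_+ᵣ_ F b a lam r r') ≋ numeratorAt N r +P numeratorAt N r'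
  numeratorAt-+ᵣ N (p , m) (q , k) le =
    ≋-trans (*P-distribʳ _ (numeratorAt (m ⊔ℕ k) (p , m)) (numeratorAt (m ⊔ℕ k) (q , k)))
      (+P-cong (numeratorAt-numeratorAt p (ℕ.m≤m⊔n m k) le) (numeratorAt-numeratorAt q (ℕ.m≤n⊔m m k) le))

  private
    +-∸-rearrange : ∀ s {m N} → m ≤ N → (m +ℕ s) +ℕ (N ∸ m) ≡ N +ℕ s
    +-∸-rearrange s {m} {N} m≤N = begin
      (m +ℕ s) +ℕ (N ∸ m)   ≡⟨ cong (_+ℕ (N ∸ m)) (ℕ.+-comm m s) ⟩
      (s +ℕ m) +ℕ (N ∸ m)   ≡⟨ ℕ.+-assoc s m (N ∸ m) ⟩
      s +ℕ (m +ℕ (N ∸ m))   ≡⟨ cong (s +ℕ_) (ℕ.m+[n∸m]≡n m≤N) ⟩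
      s +ℕ N                ≡⟨ ℕ.+-comm s N ⟩
      N +ℕ s                ∎
      where open ≡.≡-Reasoning

  numeratorAt-Deg≤ : ∀ {p m} N s → m ≤ N → Deg≤ p (m +ℕ s) → Deg≤ (numeratorAt N (p , m)) (N +ℕ s)
  numeratorAt-Deg≤ {p} {m} N s m≤N dp = ≡.subst (Deg≤ (numeratorAt N (p , m))) (+-∸-rearrange s m≤N)
    (proj₁ (Deg≤-*P p (dq m (N ∸ m)) (m +ℕ s) (N ∸ m) dp (proj₂ (dq-HasDegree m (N ∸ m)))))

  numeratorAt-HasDegree : ∀ {p m} N s → m ≤ N → HasDegree F p (m +ℕ s) →
                          HasDegree F (numeratorAt N (p , m)) (N +ℕ s)
  numeratorAt-HasDegree {p} {m} N s m≤N (top≉0 , dp) = top'≉0 , numeratorAt-Deg≤ {p} N s m≤N dp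
    where
      D = dq m (N ∸ m)
      topCoef = proj₂ (Deg≤-*P p D (m +ℕ s) (N ∸ m) dp (proj₂ (dq-HasDegree m (N ∸ m))))
      top'≉0 : ¬ (coef (numeratorAt N (p , m)) (N +ℕ s) ≈ 0#)
      top'≉0 = *-nonzero top≉0 (proj₁ (dq-HasDegree m (N ∸ m))) ∘
        trans (sym (≡.subst (λ j → coef (p *P D) j ≈ coef p (m +ℕ s) * coef D (N ∸ m)) (+-∸-rearrange s m≤N) topCoef))

  ρ : ℕ → Carrier
  ρ n = rootPt F a lam (suc n) (a≠0 n)

  ev-lin-ρ : ∀ n → ev (lin (suc n)) (ρ n) ≈ 0#
  ev-lin-ρ n = begin
    lam (suc n) + ρ n * (a (suc n) + ρ n * 0#) ≈⟨ +-congˡ (*-congˡ (trans (+-congˡ (zeroʳ _)) (+-identityʳ _))) ⟩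
    lam (suc n) + ρ n * a (suc n)              ≈⟨ +-congˡ (inv-*-cancelʳ (- lam (suc n)) (a≠0 n)) ⟩
    lam (suc n) + - lam (suc n)                ≈⟨ -‿inverseʳ _ ⟩
    0#                                         ∎
    where open SetoidReasoning setoid


  ev-numeratorAt-suc-ρ : ∀ r M → proj₂ r ≤ M → ev (numeratorAt (suc M) r) (ρ M) ≈ 0#
  ev-numeratorAt-suc-ρ (p , m) M m≤M = begin
    ev (numeratorAt (suc M) (p , m)) (ρ M)                    ≈⟨ ev-cong (ρ M) (numeratorAt-suc p m≤M) ⟩
    ev (numeratorAt M (p , m) *P lin (suc M)) (ρ M)           ≈⟨ ev-* (numeratorAt M (p , m)) (lin (suc M)) (ρ M) ⟩
    ev (numeratorAt M (p , m)) (ρ M) * ev (lin (suc M)) (ρ M) ≈⟨ *-congˡ (ev-lin-ρ M) ⟩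
    ev (numeratorAt M (p , m)) (ρ M) * 0#                     ≈⟨ zeroʳ _ ⟩
    0#                                                        ∎
    where open SetoidReasoning setoid

  -- Synthetic division by a_{n+1} (x - ρ_n).
  quotient : ℕ → Pol → Pol
  quotient n []      = []
  quotient n (x ∷ p) = (ev p (ρ n) * inv (a (suc n)) (a≠0 n)) ∷ quotient n p

  division : ∀ n p → p ≋ constP F (ev p (ρ n)) +P lin (suc n) *P quotient n p
  division n p = coeffwise λ k → trans (coef-division p k)
    (sym (trans (coef-+ (constP F (ev p (ρ n))) (lin (suc n) *P quotient n p) k) (+-congˡ (coef-lin* k))))
    where
      open SetoidReasoning setoid
      λₙ = lam (suc n)
      aₙ = a (suc n)
      a⁻¹ = inv aₙ (a≠0 n)

      coef-lin*Q : Pol → ℕ → Carrier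
      coef-lin*Q q zero    = λₙ * coef q zero
      coef-lin*Q q (suc k) = λₙ * coef q (suc k) + aₙ * coef q k

      coef-lin* : ∀ k → coef (lin (suc n) *P quotient n p) k ≈ coef-lin*Q (quotient n p) k
      coef-lin* zero    = coef-lin*-zero (suc n) (quotient n p)
      coef-lin* (suc k) = coef-lin*-suc (suc n) (quotient n p) k

      ρ-cancels : ∀ e → ρ n * e + λₙ * (e * a⁻¹) ≈ 0#
      ρ-cancels e = begin
        ρ n * e + λₙ * (e * a⁻¹)                ≈⟨ +-cong (*-assoc _ _ _) (*-congˡ (*-comm _ _)) ⟩
        (- λₙ) * (a⁻¹ * e) + λₙ * (a⁻¹ * e)     ≈⟨ distribʳ _ _ _ ⟨
        ((- λₙ) + λₙ) * (a⁻¹ * e)               ≈⟨ *-congʳ (-‿inverseˡ _) ⟩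
        0# * (a⁻¹ * e)                          ≈⟨ zeroˡ _ ⟩
        0#                                      ∎

      coef-division : ∀ p k → coef p k ≈ coef (constP F (ev p (ρ n))) k + coef-lin*Q (quotient n p) k
      coef-division [] zero    = sym (trans (+-identityˡ _) (zeroʳ _))
      coef-division [] (suc k) = sym (trans (+-identityˡ _) (trans (+-cong (zeroʳ _) (zeroʳ _)) (+-identityʳ _)))
      coef-division (x ∷ p) zero = begin
        x                                                    ≈⟨ +-identityʳ x ⟨
        x + 0#                                               ≈⟨ +-congˡ (ρ-cancels (ev p (ρ n))) ⟨
        x + (ρ n * ev p (ρ n) + λₙ * (ev p (ρ n) * a⁻¹))     ≈⟨ +-assoc _ _ _ ⟨
        (x + ρ n * ev p (ρ n)) + λₙ * (ev p (ρ n) * a⁻¹)     ∎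
      coef-division (x ∷ p) (suc zero) = begin
        coef p zero                                          ≈⟨ coef-division p zero ⟩
        ev p (ρ n) + λₙ * coef (quotient n p) zero           ≈⟨ +-comm _ _ ⟩
        λₙ * coef (quotient n p) zero + ev p (ρ n)           ≈⟨ +-congˡ (trans (*-comm _ _) (inv-*-cancelʳ _ (a≠0 n))) ⟨
        λₙ * coef (quotient n p) zero + aₙ * (ev p (ρ n) * a⁻¹) ≈⟨ +-identityˡ _ ⟨
        0# + (λₙ * coef (quotient n p) zero + aₙ * (ev p (ρ n) * a⁻¹)) ∎
      coef-division (x ∷ p) (suc (suc k)) = coef-division p (suc k)

  exact-division : ∀ n p → ev p (ρ n) ≈ 0# → p ≋ lin (suc n) *P quotient n p
  exact-division n p p[ρ]≈0 = ≋-trans (division n p)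
    (+P-cong {p = constP F (ev p (ρ n))} {p' = []} (coeffwise λ { zero → p[ρ]≈0 ; (suc k) → refl }) ≋-refl)

  +P--P-cancel : ∀ p q → q +P (p +P -P q) ≋ p
  +P--P-cancel p q = ≋-trans (PI.+-swap q p (-P q)) (≋-trans (+P-cong ≋-refl (-P-inverseʳ q)) (+P-identityʳ p))

  -- Subtracting the multiple of h that agrees with p at ρ_n leaves a multiple of the linear factor.
  module RootReduction (n : ℕ) (h : Pol) (h[ρ]≉0 : ¬ (ev h (ρ n) ≈ 0#)) (p : Pol) where
    ratio : Carrier
    ratio = ev p (ρ n) * inv (ev h (ρ n)) h[ρ]≉0

    remainder : Pol
    remainder = p +P -P (ratio ·P h)

    reduced : Pol
    reduced = quotient n remainder

    remainder[ρ]≈0 : ev remainder (ρ n) ≈ 0#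
    remainder[ρ]≈0 = begin
      ev remainder (ρ n)                       ≈⟨ ev-+ p (-P (ratio ·P h)) (ρ n) ⟩
      ev p (ρ n) + ev (-P (ratio ·P h)) (ρ n)  ≈⟨ +-congˡ (ev--P (ratio ·P h) (ρ n)) ⟩
      ev p (ρ n) + - ev (ratio ·P h) (ρ n)     ≈⟨ +-congˡ (-‿cong (trans (ev-· ratio h (ρ n)) (inv-*-cancelʳ _ h[ρ]≉0))) ⟩
      ev p (ρ n) + - ev p (ρ n)                ≈⟨ -‿inverseʳ _ ⟩
      0#                                       ∎
      where open SetoidReasoning setoid

    reduction : p ≋ ratio ·P h +P lin (suc n) *P reduced
    reduction = ≋-trans (≋-sym (+P--P-cancel p (ratio ·P h)))
                        (+P-cong {ratio ·P h} ≋-refl (exact-division n remainder remainder[ρ]≈0))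

    reduced-Deg≤ : ∀ m → Deg≤ p (suc m) → Deg≤ h (suc m) → Deg≤ reduced m
    reduced-Deg≤ m dp dh = lin-*P-Deg≤ (suc n) (s≤s z≤n) reduced m
      (λ k lt → trans (sym (coef≈ (exact-division n remainder remainder[ρ]≈0) k))
                      (Deg≤-+ {p} { -P (ratio ·P h)} dp (Deg≤--P {ratio ·P h} (Deg≤-· {h} ratio dh)) k lt))

module Combinations {c ℓ : Level} (F : Field c ℓ) (b a lam : ℕ → Field.Carrier F)
                    (a≠0 : (n : ℕ) → ¬ (Field._≈_ F (a (suc n)) (Field.0# F)))
                    {I : Set} (B : I → RF F b a lam) where
  open Field F hiding (zero)
  open Polynomials F
  open CommonDenominators F b a lam a≠0
  private module PI = PolynomialIdentities F

  Terms : Set c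
  Terms = List (Carrier × I)

  combination : Terms → Frac
  combination = combFam F b a lam B

  numeratorSumAt : ℕ → Terms → Pol
  numeratorSumAt N []            = []
  numeratorSumAt N ((s , i) ∷ L) = s ·P numeratorAt N (B i) +P numeratorSumAt N L

  numeratorAt-combination : ∀ L N → proj₂ (combination L) ≤ N →
                            numeratorAt N (combination L) ≋ numeratorSumAt N L
  numeratorAt-combination []            N le = ≋-refl
  numeratorAt-combination ((s , i) ∷ L) N le =
    ≋-trans (numeratorAt-+ᵣ N (_·ᵣ_ F b a lam s (B i)) (combination L) le)
      (+P-cong (·P-*P-assoc s (proj₁ (B i)) _)
               (numeratorAt-combination L N (ℕ.≤-trans (ℕ.m≤n⊔m (proj₂ (B i)) _) le)))

  numeratorSumAt-suc : ∀ L N → proj₂ (combination L) ≤ N →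
                       numeratorSumAt (suc N) L ≋ numeratorSumAt N L *P lin (suc N)
  numeratorSumAt-suc []            N le = ≋-refl
  numeratorSumAt-suc ((s , i) ∷ L) N le = begin
    s ·P numeratorAt (suc N) (B i) +P numeratorSumAt (suc N) L
      ≈⟨ +P-cong (·P-cong refl (numeratorAt-suc (proj₁ (B i)) (ℕ.≤-trans (ℕ.m≤m⊔n (proj₂ (B i)) _) le)))
                 (numeratorSumAt-suc L N (ℕ.≤-trans (ℕ.m≤n⊔m (proj₂ (B i)) _) le)) ⟩
    s ·P (numeratorAt N (B i) *P lin (suc N)) +P numeratorSumAt N L *P lin (suc N)
      ≈⟨ +P-cong (·P-*P-assoc s (numeratorAt N (B i)) (lin (suc N))) ≋-refl ⟨
    (s ·P numeratorAt N (B i)) *P lin (suc N) +P numeratorSumAt N L *P lin (suc N)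
      ≈⟨ *P-distribʳ (lin (suc N)) (s ·P numeratorAt N (B i)) (numeratorSumAt N L) ⟨
    numeratorSumAt N L' *P lin (suc N) ∎
    where
      open ≋-Reasoning
      L' = (s , i) ∷ L


  combination-level≤⇒All : ∀ L N → proj₂ (combination L) ≤ N → All (λ e → proj₂ (B (proj₂ e)) ≤ N) L
  combination-level≤⇒All []            N le = []
  combination-level≤⇒All ((s , i) ∷ L) N le =
    ℕ.≤-trans (ℕ.m≤m⊔n (proj₂ (B i)) _) le ∷ combination-level≤⇒All L N (ℕ.≤-trans (ℕ.m≤n⊔m (proj₂ (B i)) _) le)

  All⇒combination-level≤ : ∀ L N → All (λ e → proj₂ (B (proj₂ e)) ≤ N) L → proj₂ (combination L) ≤ N
  All⇒combination-level≤ []      N []         = z≤n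
  All⇒combination-level≤ (_ ∷ L) N (le ∷ les) = ℕ.⊔-lub le (All⇒combination-level≤ L N les)

  combination≈0⇒numeratorSumAt≋[] : ∀ L → _≈ᵣ_ F b a lam (combination L) (zeroR F b a lam) →
                                     ∀ N → proj₂ (combination L) ≤ N → numeratorSumAt N L ≋ []
  combination≈0⇒numeratorSumAt≋[] L L≈0 N le = ≋-trans (≋-sym (numeratorAt-combination L N le))
    (*P-zeroˡ (proj₁ (combination L)) _ (≋-trans (≋-sym (*P-identityʳ (proj₁ (combination L)))) (coeffwise L≈0)))

  record RepresentsAt (L : Terms) (N : ℕ) (r : Frac) : Set ℓ where
    constructor representsAt
    field
      level≤             : proj₂ r ≤ N
      combination-level≤ : proj₂ (combination L) ≤ N
      numerators≋        : numeratorSumAt N L ≋ numeratorAt N r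

  Representable : Frac → Set (c ⊔ ℓ)
  Representable r = Σ Terms λ L → Σ ℕ λ N → RepresentsAt L N r

  RepresentsAt-suc : ∀ {L N p m} → RepresentsAt L N (p , m) → RepresentsAt L (suc N) (p , m)
  RepresentsAt-suc {L} {N} {p} (representsAt m≤N l≤N e) =
    representsAt (ℕ.m≤n⇒m≤1+n m≤N) (ℕ.m≤n⇒m≤1+n l≤N)
      (≋-trans (numeratorSumAt-suc L N l≤N) (≋-trans (*P-congʳ _ e) (≋-sym (numeratorAt-suc p m≤N))))

  RepresentsAt-mono : ∀ {L N N' r} → N ≤ N' → RepresentsAt L N r → RepresentsAt L N' r
  RepresentsAt-mono N≤N' h = go (ℕ.≤⇒≤′ N≤N')
    where
      go : ∀ {N'} → _ ≤′ N' → RepresentsAt _ N' _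
      go ≤′-refl        = h
      go (≤′-step N≤′N') = RepresentsAt-suc (go N≤′N')

  Representable-raise : ∀ {q m M} → m ≤ M → Representable (q , m) → Representable (numeratorAt M (q , m) , M)
  Representable-raise {q} {m} {M} m≤M (L , N , h) with RepresentsAt-mono (ℕ.m≤m⊔n N M) h
  ... | representsAt _ l≤N' e = L , N ⊔ℕ M ,
        representsAt (ℕ.m≤n⊔m N M) l≤N' (≋-trans e (≋-sym (numeratorAt-numeratorAt q m≤M (ℕ.m≤n⊔m N M))))

  Representable-lower : ∀ {p m M} → m ≤ M → Representable (numeratorAt M (p , m) , M) → Representable (p , m)
  Representable-lower {p} m≤M (L , N , representsAt M≤N l≤N e) =
    L , N , representsAt (ℕ.≤-trans m≤M M≤N) l≤N (≋-trans e (numeratorAt-numeratorAt p m≤M M≤N))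

  Representable-[] : ∀ M → Representable ([] , M)
  Representable-[] M = [] , M , representsAt ℕ.≤-refl z≤n ≋-refl

  Representable-∷ : ∀ {q M p} s i → proj₂ (B i) ≤ M → p ≋ s ·P numeratorAt M (B i) +P q →
                    Representable (q , M) → Representable (p , M)
  Representable-∷ {q} {M} {p} s i i≤M p≋ (L , N , representsAt M≤N l≤N e) =
    (s , i) ∷ L , N , representsAt M≤N (ℕ.⊔-lub (ℕ.≤-trans i≤M M≤N) l≤N) (begin
      s ·P numeratorAt N (B i) +P numeratorSumAt N L
        ≈⟨ +P-cong (·P-cong refl (≋-sym (numeratorAt-numeratorAt (proj₁ (B i)) i≤M M≤N))) e ⟩
      s ·P numeratorAt N (numeratorAt M (B i) , M) +P numeratorAt N (q , M)
        ≈⟨ +P-cong (·P-*P-assoc s (numeratorAt M (B i)) _) ≋-refl ⟨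
      numeratorAt N (s ·P numeratorAt M (B i) , M) +P numeratorAt N (q , M)
        ≈⟨ *P-distribʳ _ (s ·P numeratorAt M (B i)) q ⟨
      numeratorAt N (s ·P numeratorAt M (B i) +P q , M)
        ≈⟨ *P-congʳ _ p≋ ⟨
      numeratorAt N (p , M) ∎)
    where open ≋-Reasoning

  Representable-reduce : ∀ m i h (h[ρ]≉0 : ¬ (ev h (ρ m) ≈ 0#)) → B i ≡ (h , suc m) → ∀ p →
    Representable (RootReduction.reduced m h h[ρ]≉0 p , m) → Representable (p , suc m)
  Representable-reduce m i h h[ρ]≉0 Bi≡ p rep = Representable-∷ (ratio) i (ℕ.≤-reflexive (cong proj₂ Bi≡)) (begin
      p                                                  ≈⟨ reduction ⟩
      ratio ·P h +P lin (suc m) *P reduced               ≈⟨ +P-cong (·P-cong refl h≋) lin*≋ ⟩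
      ratio ·P numeratorAt (suc m) (B i) +P numeratorAt (suc m) (reduced , m) ∎)
    (Representable-raise (ℕ.n≤1+n m) rep)
    where
      open RootReduction m h h[ρ]≉0 p
      open ≋-Reasoning
      h≋ : h ≋ numeratorAt (suc m) (B i)
      h≋ = ≋-sym (≋-trans (≋-reflexive (cong (numeratorAt (suc m)) Bi≡)) (numeratorAt-self h (suc m)))
      lin*≋ : lin (suc m) *P reduced ≋ numeratorAt (suc m) (reduced , m)
      lin*≋ = ≋-trans (*P-comm _ reduced)
        (≋-sym (≋-trans (numeratorAt-suc reduced ℕ.≤-refl) (*P-congʳ _ (numeratorAt-self reduced m))))

  Representable⇒spanned : ∀ {r} → Representable r → ∃ λ L → _≈ᵣ_ F b a lam (combination L) r
  Representable⇒spanned {p , m} (L , N , representsAt m≤N l≤N e) =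
    L , coef≈ (den-*P-cancel N (num *P den m) (p *P den M) (begin
      (num *P den m) *P den N                         ≈⟨ *P-congˡ (num *P den m) (den-numeratorAt l≤N) ⟩
      (num *P den m) *P (den M *P dq M (N ∸ M))       ≈⟨ PI.*-interchange num (den m) (den M) _ ⟩
      numeratorAt N (num , M) *P (den m *P den M)     ≈⟨ *P-congʳ _ (≋-trans (numeratorAt-combination L N l≤N) e) ⟩
      numeratorAt N (p , m) *P (den m *P den M)       ≈⟨ PI.*-interchange p _ (den m) (den M) ⟩
      (p *P den M) *P (dq m (N ∸ m) *P den m)         ≈⟨ *P-congˡ (p *P den M) (*P-comm _ (den m)) ⟩
      (p *P den M) *P (den m *P dq m (N ∸ m))         ≈⟨ *P-congˡ (p *P den M) (den-numeratorAt m≤N) ⟨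
      (p *P den M) *P den N                           ∎))
    where
      open ≋-Reasoning
      num = proj₁ (combination L)
      M = proj₂ (combination L)

module SpanningByMonomialMultiples {c ℓ : Level} (F : Field c ℓ) (b a lam : ℕ → Field.Carrier F)
    (a≠0 : (n : ℕ) → ¬ (Field._≈_ F (a (suc n)) (Field.0# F)))
    (P[ρ]≉0 : (n : ℕ) → ¬ (Field._≈_ F (eval F (P F b a lam (suc n)) (rootPt F a lam (suc n) (a≠0 n))) (Field.0# F)))
    where
  open Field F hiding (zero)
  open Polynomials F
  open CommonDenominators F b a lam a≠0
  open Combinations F b a lam a≠0 (xQ F b a lam)

  -- x^k p as the combination Σ_j p_j · x^(k+j) Q_0 (recall Q_0 = 1)
  monomialTerms : ℕ → Pol → Terms
  monomialTerms k []      = []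
  monomialTerms k (x ∷ p) = (x , (k , 0)) ∷ monomialTerms (suc k) p

  combination-level-monomialTerms : ∀ k p → proj₂ (combination (monomialTerms k p)) ≡ 0
  combination-level-monomialTerms k []      = ≡.refl
  combination-level-monomialTerms k (x ∷ p) = combination-level-monomialTerms (suc k) p

  numeratorSumAt-monomialTerms : ∀ k p → numeratorSumAt 0 (monomialTerms k p) ≋ Xpow F k *P p
  numeratorSumAt-monomialTerms k []      = ≋-sym (*P-zeroʳ (Xpow F k))
  numeratorSumAt-monomialTerms k (x ∷ p) = begin
    x ·P ((Xpow F k *P oneP F) *P oneP F) +P numeratorSumAt 0 (monomialTerms (suc k) p)
      ≈⟨ +P-cong (·P-cong refl (≋-trans (*P-identityʳ _) (*P-identityʳ _))) (numeratorSumAt-monomialTerms (suc k) p) ⟩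
    x ·P Xpow F k +P (X F *P Xpow F k) *P p
      ≈⟨ +P-cong ≋-refl (≋-trans (*P-assoc (X F) (Xpow F k) p) (≋-trans (X-*P _) (shift-cong (*P-comm (Xpow F k) p)))) ⟩
    (x ∷ p) *P Xpow F k
      ≈⟨ *P-comm (x ∷ p) (Xpow F k) ⟩
    Xpow F k *P (x ∷ p) ∎
    where open ≋-Reasoning

  Representable-xQ : ∀ m p → Representable (p , m)
  Representable-xQ zero p = monomialTerms 0 p , 0 ,
    representsAt z≤n (ℕ.≤-reflexive (combination-level-monomialTerms 0 p))
      (≋-trans (numeratorSumAt-monomialTerms 0 p) (≋-trans (*P-identityˡ p) (≋-sym (numeratorAt-self p 0))))
  Representable-xQ (suc m) p =
    Representable-reduce m (0 , suc m) Pₘ Pₘ[ρ]≉0 ≡.refl p (Representable-xQ m _)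
    where
      Pₘ = oneP F *P P F b a lam (suc m)
      Pₘ[ρ]≉0 : ¬ (ev Pₘ (ρ m) ≈ 0#)
      Pₘ[ρ]≉0 = P[ρ]≉0 m ∘ trans (sym (ev-cong (ρ m) (*P-identityˡ (P F b a lam (suc m)))))


  fraction∈V : ∀ r → InV F b a lam r
  fraction∈V (p , m) = Representable⇒spanned (Representable-xQ m p)

module BasisB {c ℓ : Level} (F : Field c ℓ) (b a lam : ℕ → Field.Carrier F)
    (a≠0 : (n : ℕ) → ¬ (Field._≈_ F (a (suc n)) (Field.0# F)))
    (t : ℕ → ℕ) (f g : ℕ → Poly F)
    (f-deg : (n : ℕ) → HasDegree F (f (suc n)) (suc n +ℕ t (suc n)))
    (g-deg : (n : ℕ) → DegreeAtMost F (g n) n)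
    (g₀≉0 : ¬ (Field._≈_ F (coeff F (g 0) 0) (Field.0# F)))
    (g[ρ]≉0 : (n : ℕ) → ¬ (Field._≈_ F (eval F (g (suc n)) (rootPt F a lam (suc n) (a≠0 n))) (Field.0# F)))
    where
  open Field F hiding (zero)
  open FieldFacts F
  open Polynomials F
  private module PI = PolynomialIdentities F
  open CommonDenominators F b a lam a≠0
  open Combinations F b a lam a≠0 (familyB F t f g)

  B : ℕ ⊎ ℕ → Frac
  B = familyB F t f g

  f-numeratorAt-HasDegree : ∀ n N → t (suc n) ≤ N → HasDegree F (numeratorAt N (B (inj₁ n))) (N +ℕ suc n)
  f-numeratorAt-HasDegree n N t≤N = numeratorAt-HasDegree {f (suc n)} N (suc n) t≤N
    (≡.subst (HasDegree F (f (suc n))) (ℕ.+-comm (suc n) (t (suc n))) (f-deg n))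

  g-numeratorAt-Deg≤ : ∀ j N → j ≤ N → Deg≤ (numeratorAt N (B (inj₂ j))) (N +ℕ 0)
  g-numeratorAt-Deg≤ j N j≤N = numeratorAt-Deg≤ {g j} N 0 j≤N (≡.subst (Deg≤ (g j)) (≡.sym (ℕ.+-identityʳ j)) (g-deg j))

  Representable-g : ∀ m p → Deg≤ p m → Representable (p , m)
  Representable-g zero p dp = Representable-∷ ratio (inj₂ 0) z≤n p≋ (Representable-[] 0)
    where
      h = numeratorAt 0 (g 0 , 0)
      h-deg : HasDegree F h 0
      h-deg = numeratorAt-HasDegree {g 0} 0 0 z≤n (g₀≉0 , g-deg 0)
      ratio = leadingRatio p h 0 (proj₁ h-deg)
      p≋ : p ≋ ratio ·P h +P []
      p≋ = ≋-trans (≋-sym (+P--P-cancel p (ratio ·P h)))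
                   (+P-cong {ratio ·P h} ≋-refl (coeffwise λ k → cancel-leading p h 0 h-deg dp k z≤n))
  Representable-g (suc m) p dp =
    Representable-reduce m (inj₂ (suc m)) (g (suc m)) (g[ρ]≉0 m) ≡.refl p
      (Representable-g m _ (RootReduction.reduced-Deg≤ m (g (suc m)) (g[ρ]≉0 m) p m dp (g-deg (suc m))))

  -- Lift p / d_m and f_{n+1} / d_{t_{n+1}} to the common level m ⊔ t_{n+1} and cancel the top coefficient.
  Representable-f : ∀ n m p → Deg≤ p (m +ℕ n) → Representable (p , m)
  Representable-f zero    m p dp = Representable-g m p (≡.subst (Deg≤ p) (ℕ.+-identityʳ m) dp)
  Representable-f (suc n) m p dp =
    Representable-lower m≤M (Representable-∷ ratio (inj₁ n) t≤M p'≋ (Representable-f n M _ reduced-deg))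
    where
      tₙ = t (suc n)
      M = m ⊔ℕ tₙ
      m≤M = ℕ.m≤m⊔n m tₙ
      t≤M = ℕ.m≤n⊔m m tₙ
      M+1+n≡ = ℕ.+-suc M n
      p' = numeratorAt M (p , m)
      f' = numeratorAt M (f (suc n) , tₙ)
      f'-deg : HasDegree F f' (suc (M +ℕ n))
      f'-deg = ≡.subst (HasDegree F f') M+1+n≡ (f-numeratorAt-HasDegree n M t≤M)
      p'-deg : Deg≤ p' (suc (M +ℕ n))
      p'-deg = ≡.subst (Deg≤ p') M+1+n≡ (numeratorAt-Deg≤ {p} M (suc n) m≤M dp)
      ratio = leadingRatio p' f' (suc (M +ℕ n)) (proj₁ f'-deg)
      reduced-deg : Deg≤ (p' +P -P (ratio ·P f')) (M +ℕ n)
      reduced-deg = cancel-leading p' f' (suc (M +ℕ n)) f'-deg p'-deg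
      p'≋ : p' ≋ ratio ·P f' +P (p' +P -P (ratio ·P f'))
      p'≋ = ≋-sym (+P--P-cancel p' (ratio ·P f'))

  Representable-B : ∀ p m → Representable (p , m)
  Representable-B p m = Representable-f (length p) m p (Deg≤-mono {p} (ℕ.m≤n+m _ m) (Deg≤-length p))


  spans : ∀ r → ∃ λ L → _≈ᵣ_ F b a lam (combination L) r
  spans (p , m) = Representable⇒spanned (Representable-B p m)

  Index : Set
  Index = ℕ ⊎ ℕ

  _≟ᵢ_ : DecidableEquality Index
  _≟ᵢ_ = ≡-dec ℕ._≟_ ℕ._≟_

  -- L may repeat indices; their coefficients add up.
  totalCoefficient : Index → Terms → Carrier
  totalCoefficient i []            = 0#
  totalCoefficient i ((s , j) ∷ L) with j ≟ᵢ i
  ... | yes _ = s + totalCoefficient i L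
  ... | no  _ = totalCoefficient i L

  without : Index → Terms → Terms
  without i []            = []
  without i ((s , j) ∷ L) with j ≟ᵢ i
  ... | yes _ = without i L
  ... | no  _ = (s , j) ∷ without i L

  totalCoefficient-absent : ∀ i L → All (λ e → proj₂ e ≢ i) L → totalCoefficient i L ≈ 0#
  totalCoefficient-absent i []            []         = refl
  totalCoefficient-absent i ((s , j) ∷ L) (j≢i ∷ ne) with j ≟ᵢ i
  ... | yes j≡i = contradiction j≡i j≢i
  ... | no  _   = totalCoefficient-absent i L ne

  totalCoefficient-without : ∀ i i' L → i' ≢ i → totalCoefficient i' (without i L) ≈ totalCoefficient i' L
  totalCoefficient-without i i' []            i'≢i = refl
  totalCoefficient-without i i' ((s , j) ∷ L) i'≢i with j ≟ᵢ i
  ... | yes ≡.refl with j ≟ᵢ i'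
  ...   | yes ≡.refl = contradiction ≡.refl i'≢i
  ...   | no  _      = totalCoefficient-without i i' L i'≢i
  totalCoefficient-without i i' ((s , j) ∷ L) i'≢i | no _ with j ≟ᵢ i'
  ...   | yes _ = +-congˡ (totalCoefficient-without i i' L i'≢i)
  ...   | no  _ = totalCoefficient-without i i' L i'≢i

  All-without : ∀ {P : Carrier × Index → Set} i L → All P L → All (λ e → P e × proj₂ e ≢ i) (without i L)
  All-without i []            []         = []
  All-without i ((s , j) ∷ L) (pj ∷ ps) with j ≟ᵢ i
  ... | yes _   = All-without i L ps
  ... | no  j≢i = (pj , j≢i) ∷ All-without i L ps

  numeratorSumAt-without : ∀ N i L →
    numeratorSumAt N L ≋ totalCoefficient i L ·P numeratorAt N (B i) +P numeratorSumAt N (without i L)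
  numeratorSumAt-without N i [] = ≋-sym (≋-trans (+P-identityʳ _) (·P-zero _))
  numeratorSumAt-without N i ((s , j) ∷ L) with j ≟ᵢ i
  ... | yes ≡.refl = ≋-trans (+P-cong ≋-refl (numeratorSumAt-without N j L))
          (≋-trans (≋-sym (+P-assoc (s ·P numeratorAt N (B j)) _ _))
                   (+P-cong (≋-sym (·P-distribʳ s (totalCoefficient j L) (numeratorAt N (B j)))) ≋-refl))
  ... | no _ = ≋-trans (+P-cong ≋-refl (numeratorSumAt-without N i L))
                 (PI.+-swap (s ·P numeratorAt N (B j)) (totalCoefficient i L ·P numeratorAt N (B i)) _)

  numeratorSumAt-without-≋[] : ∀ N i L → totalCoefficient i L ≈ 0# → numeratorSumAt N L ≋ [] →
                               numeratorSumAt N (without i L) ≋ []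
  numeratorSumAt-without-≋[] N i L tc≈0 L≋[] = begin
    numeratorSumAt N (without i L)                                       ≈⟨ +P-cong (·P-zero (numeratorAt N (B i))) ≋-refl ⟨
    0# ·P numeratorAt N (B i) +P numeratorSumAt N (without i L)          ≈⟨ +P-cong (·P-cong {p = numeratorAt N (B i)} tc≈0 ≋-refl) ≋-refl ⟨
    totalCoefficient i L ·P numeratorAt N (B i) +P numeratorSumAt N (without i L) ≈⟨ numeratorSumAt-without N i L ⟨
    numeratorSumAt N L                                                   ≈⟨ L≋[] ⟩
    []                                                                   ∎
    where open ≋-Reasoning

  totalCoefficients-peel : ∀ i L → totalCoefficient i L ≈ 0# →
    (∀ j → totalCoefficient j (without i L) ≈ 0#) → ∀ j → totalCoefficient j L ≈ 0#
  totalCoefficients-peel i L tcᵢ≈0 rest j with j ≟ᵢ i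
  ... | yes ≡.refl = tcᵢ≈0
  ... | no  j≢i    = trans (sym (totalCoefficient-without i j L j≢i)) (rest j)

  module _ (φ : LinearFunctional) (N : ℕ) (i : Index) where
    open LinearFunctional φ

    functional-numeratorSumAt : ∀ L → All (λ e → proj₂ e ≢ i → apply (numeratorAt N (B (proj₂ e))) ≈ 0#) L →
      apply (numeratorSumAt N L) ≈ totalCoefficient i L * apply (numeratorAt N (B i))
    functional-numeratorSumAt []            []         = trans (apply-≋[] [] ≋-refl) (sym (zeroˡ _))
    functional-numeratorSumAt ((s , j) ∷ L) (φⱼ≈0 ∷ hs) with j ≟ᵢ i
    ... | yes ≡.refl = trans (apply-+ _ _) (trans (+-cong (apply-· s _) (functional-numeratorSumAt L hs)) (sym (distribʳ _ _ _)))
    ... | no  j≢i    = trans (apply-+ _ _) (trans (+-cong (trans (apply-· s _) (trans (*-congˡ (φⱼ≈0 j≢i)) (zeroʳ s)))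
                                                         (functional-numeratorSumAt L hs)) (+-identityˡ _))

    totalCoefficient-detected : ∀ L → numeratorSumAt N L ≋ [] → ¬ (apply (numeratorAt N (B i)) ≈ 0#) →
      All (λ e → proj₂ e ≢ i → apply (numeratorAt N (B (proj₂ e))) ≈ 0#) L → totalCoefficient i L ≈ 0#
    totalCoefficient-detected L L≋[] φᵢ≉0 hs = nonzero-*-cancel φᵢ≉0
      (trans (*-comm _ _) (trans (sym (functional-numeratorSumAt L hs)) (apply-≋[] _ L≋[])))

  Admissible : ℕ → ℕ → Index → Set
  Admissible K N (inj₁ n) = n < K × t (suc n) ≤ N
  Admissible K N (inj₂ j) = j ≤ N

  Admissible-level : ∀ K N i → Admissible K N i → proj₂ (B i) ≤ N
  Admissible-level K N (inj₁ n) (_ , t≤N) = t≤N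
  Admissible-level K N (inj₂ j) j≤N       = j≤N

  Admissible-mono : ∀ {K K'} N i → K ≤ K' → Admissible K N i → Admissible K' N i
  Admissible-mono N (inj₁ n) K≤K' (n<K , t≤N) = ℕ.≤-trans n<K K≤K' , t≤N
  Admissible-mono N (inj₂ j) K≤K' j≤N         = j≤N

  Admissible-Deg≤ : ∀ K N i → Admissible K N i → Deg≤ (numeratorAt N (B i)) (N +ℕ K)
  Admissible-Deg≤ K N (inj₁ n) (n<K , t≤N) =
    Deg≤-mono {numeratorAt N (B (inj₁ n))} (ℕ.+-monoʳ-≤ N n<K) (proj₂ (f-numeratorAt-HasDegree n N t≤N))
  Admissible-Deg≤ K N (inj₂ j) j≤N =
    Deg≤-mono {numeratorAt N (B (inj₂ j))} (ℕ.+-monoʳ-≤ N z≤n) (g-numeratorAt-Deg≤ j N j≤N)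

  Admissible-lower-g : ∀ M i → Admissible 0 (suc M) i → i ≢ inj₂ (suc M) → Admissible 0 M i
  Admissible-lower-g M (inj₂ j) j≤1+M i≢ = ℕ.<⇒≤pred (ℕ.≤∧≢⇒< j≤1+M (i≢ ∘ cong inj₂))

  Admissible-lower-f : ∀ K N i → Admissible (suc K) N i → i ≢ inj₁ K → Admissible K N i
  Admissible-lower-f K N (inj₁ n) (n<1+K , t≤N) i≢ = ℕ.≤∧≢⇒< (ℕ.<⇒≤pred n<1+K) (i≢ ∘ cong inj₁) , t≤N
  Admissible-lower-f K N (inj₂ j) j≤N           i≢ = j≤N

  -- Induction on the level: at level M + 1 only g_{M+1} survives evaluation at ρ_M.
  g-terms-independent : ∀ N L → All (Admissible 0 N ∘ proj₂) L → numeratorSumAt N L ≋ [] →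
                        ∀ i → totalCoefficient i L ≈ 0#
  g-terms-independent zero L hs L≋[] =
    totalCoefficients-peel (inj₂ 0) L tc≈0 (λ j → totalCoefficient-absent j _ (All.map (λ (h , i≢) _ → contradiction (only-g₀ h) i≢) (All-without (inj₂ 0) L hs)))
    where
      only-g₀ : ∀ {i} → Admissible 0 0 i → i ≡ inj₂ 0
      only-g₀ {inj₂ zero} z≤n = ≡.refl
      g₀≉0' : ¬ (coef (numeratorAt 0 (B (inj₂ 0))) 0 ≈ 0#)
      g₀≉0' = g₀≉0 ∘ trans (sym (coef≈ (numeratorAt-self (g 0) 0) 0))
      tc≈0 = totalCoefficient-detected (coefficientAt 0) 0 (inj₂ 0) L L≋[] g₀≉0'
               (All.map (λ h i≢ → contradiction (only-g₀ h) i≢) hs)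
  g-terms-independent (suc M) L hs L≋[] = totalCoefficients-peel i L tcᵢ≈0 (g-terms-independent M L' hs' L'≋[])
    where
      i = inj₂ (suc M)
      L' = without i L
      g[ρ]≉0' : ¬ (ev (numeratorAt (suc M) (B i)) (ρ M) ≈ 0#)
      g[ρ]≉0' = g[ρ]≉0 M ∘ trans (sym (ev-cong (ρ M) (numeratorAt-self (g (suc M)) (suc M))))
      tcᵢ≈0 = totalCoefficient-detected (evaluationAt (ρ M)) (suc M) i L L≋[] g[ρ]≉0'
        (All.map (λ {e} h i≢ → ev-numeratorAt-suc-ρ (B (proj₂ e)) M
                   (Admissible-level 0 M (proj₂ e) (Admissible-lower-g M (proj₂ e) h i≢))) hs)
      hs' : All (Admissible 0 M ∘ proj₂) L'
      hs' = All.map (λ {e} (h , i≢) → Admissible-lower-g M (proj₂ e) h i≢) (All-without i L hs)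
      L'≋[] : numeratorSumAt M L' ≋ []
      L'≋[] = lin-*P-cancel (suc M) (s≤s z≤n) (numeratorSumAt M L')
        (≋-trans (*P-comm _ _) (≋-trans
          (≋-sym (numeratorSumAt-suc L' M (All⇒combination-level≤ L' M (All.map (λ {e} → Admissible-level 0 M (proj₂ e)) hs'))))
          (numeratorSumAt-without-≋[] (suc M) i L tcᵢ≈0 L≋[])))

  -- Induction on the bound K of the f-indices: f_{K+1} has the largest degree, N + K + 1, over d_N.
  terms-independent : ∀ K N L → All (Admissible K N ∘ proj₂) L → numeratorSumAt N L ≋ [] →
                      ∀ i → totalCoefficient i L ≈ 0#
  terms-independent zero    N L hs L≋[] = g-terms-independent N L hs L≋[]
  terms-independent (suc K) N L hs L≋[] =
    totalCoefficients-peel i L tcᵢ≈0 (terms-independent K N L' hs' (numeratorSumAt-without-≋[] N i L tcᵢ≈0 L≋[]))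
    where
      i = inj₁ K
      L' = without i L
      tcᵢ≈0 : totalCoefficient i L ≈ 0#
      tcᵢ≈0 with t (suc K) ℕ.≤? N
      ... | yes t≤N = totalCoefficient-detected (coefficientAt (N +ℕ suc K)) N i L L≋[]
            (proj₁ (f-numeratorAt-HasDegree K N t≤N))
            (All.map (λ {e} h i≢ → Admissible-Deg≤ K N (proj₂ e) (Admissible-lower-f K N (proj₂ e) h i≢)
                                     (N +ℕ suc K) (ℕ.+-monoʳ-< N ℕ.≤-refl)) hs)
      ... | no  t≰N = totalCoefficient-absent i L (All.map (λ {e} → absent (proj₂ e)) hs)
        where absent : ∀ j → Admissible (suc K) N j → j ≢ i
              absent (inj₁ .K) (_ , t≤N) ≡.refl = t≰N t≤N
      hs' : All (Admissible K N ∘ proj₂) L'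
      hs' = All.map (λ {e} (h , i≢) → Admissible-lower-f K N (proj₂ e) h i≢) (All-without i L hs)

  fIndexBound : Terms → ℕ
  fIndexBound []                  = 0
  fIndexBound ((s , inj₁ n) ∷ L) = suc n ⊔ℕ fIndexBound L
  fIndexBound ((s , inj₂ j) ∷ L) = fIndexBound L

  All-Admissible : ∀ L N → All (λ e → proj₂ (B (proj₂ e)) ≤ N) L → All (Admissible (fIndexBound L) N ∘ proj₂) L
  All-Admissible []                 N []          = []
  All-Admissible ((s , inj₁ n) ∷ L) N (t≤N ∷ les) =
    (ℕ.m≤m⊔n (suc n) (fIndexBound L) , t≤N) ∷
      All.map (λ {e} → Admissible-mono N (proj₂ e) (ℕ.m≤n⊔m (suc n) (fIndexBound L))) (All-Admissible L N les)
  All-Admissible ((s , inj₂ j) ∷ L) N (j≤N ∷ les) = j≤N ∷ All-Admissible L N les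

  totalCoefficient-unique : ∀ L → Unique (map proj₂ L) → All (λ e → totalCoefficient (proj₂ e) L ≈ proj₁ e) L
  totalCoefficient-unique []            []          = []
  totalCoefficient-unique ((s , i) ∷ L) (i∉ ∷ uniq) =
    head ∷ All.zipWith (λ {e} (i≢ , tc≈) → trans (tail-only (proj₂ e) i≢) tc≈) (i≢L , totalCoefficient-unique L uniq)
    where
      i≢L : All (λ e → i ≢ proj₂ e) L
      i≢L = AllP.map⁻ i∉
      tail-only : ∀ j → i ≢ j → totalCoefficient j ((s , i) ∷ L) ≈ totalCoefficient j L
      tail-only j i≢j with i ≟ᵢ j
      ... | yes i≡j = contradiction i≡j i≢j
      ... | no  _   = refl
      head : totalCoefficient i ((s , i) ∷ L) ≈ s
      head with i ≟ᵢ i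
      ... | yes _   = trans (+-congˡ (totalCoefficient-absent i L (All.map (_∘ ≡.sym) i≢L))) (+-identityʳ s)
      ... | no  i≢i = contradiction ≡.refl i≢i

  linearlyIndependent : ∀ L → Unique (map proj₂ L) → _≈ᵣ_ F b a lam (combination L) (zeroR F b a lam) →
                        All (λ e → proj₁ e ≈ 0#) L
  linearlyIndependent L uniq L≈0 =
    All.map (λ {e} tc≈s → trans (sym tc≈s) (all-zero (proj₂ e))) (totalCoefficient-unique L uniq)
    where
      N = proj₂ (combination L)
      all-zero = terms-independent (fIndexBound L) N L (All-Admissible L N (combination-level≤⇒All L N ℕ.≤-refl))
                   (combination≈0⇒numeratorSumAt≋[] L L≈0 N ℕ.≤-refl)

proposition2p4 : {c ℓ : Level} (F : Field c ℓ) →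
    let open Field F in
    (b a lam : ℕ → Carrier) →
    (a≠0 : (n : ℕ) → ¬ (a (suc n) ≈ 0#)) →
    ((n : ℕ) → ¬ (eval F (P F b a lam (suc n)) (rootPt F a lam (suc n) (a≠0 n)) ≈ 0#)) →
    (t : ℕ → ℕ) (f : ℕ → Poly F) (g : ℕ → Poly F) →
    ((n : ℕ) → HasDegree F (f (suc n)) (suc n +ℕ t (suc n))) →
    ((n : ℕ) → DegreeAtMost F (g n) n) →
    ¬ (coeff F (g 0) 0 ≈ 0#) →
    ((n : ℕ) → ¬ (eval F (g (suc n)) (rootPt F a lam (suc n) (a≠0 n)) ≈ 0#)) →
    IsBasisOfV F b a lam
      (familyB F t f g)
proposition2p4 F b a lam a≠0 P[ρ]≉0 t f g f-deg g-deg g₀≉0 g[ρ]≉0 =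
  (λ i → V.fraction∈V (familyB F t f g i)) , (λ r _ → B.spans r) , B.linearlyIndependent
  where
    module V = SpanningByMonomialMultiples F b a lam a≠0 P[ρ]≉0
    module B = BasisB F b a lam a≠0 t f g f-deg g-deg g₀≉0 g[ρ]≉0
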